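{- Let $c$ be a natural number, let $P$ be a finite set of points in the plane with coordinates $(A_i,a_i)$, and let $L$ be a finite set of lines with equations $B_jx-b_jy=c$, where all $A_i,a_i,B_j,b_j$ are natural numbers. Suppose that $\gcd(A_i,c)=\gcd(a_i,c)=1$ for all points and $\gcd(B_j,c)=\gcd(b_j,c)=1$ for all lines. Then the bipartite incidence graph of this configuration (one part is $P$, the other is $L$, and a point is joined to a line iff the point lies on the line, i.e. $A_iB_j-a_ib_j=c$) contains no cycles.
   Context: Such a configuration (natural-number coordinates for points, lines of the form $Bx-by=c$ with natural $B,b$ and a common free term $c$) is called normed natural; with the coprimality conditions above it is called prime. -}

module Defs where

open import Data.Nat using (ℕ; suc; _+_; _*_; _≤_)
open import Data.Nat.GCD using (gcd)
open import Data.Product using (_×_; _,_)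
open import Data.Fin using (Fin; zero; suc; inject₁; fromℕ)
open import Data.List using (List)
open import Data.List.Membership.Propositional using (_∈_)
open import Function.Definitions using (Injective)
open import Relation.Binary.PropositionalEquality using (_≡_)

Point : Set
Point = ℕ × ℕ

-- A line (B , b) is the line  B x - b y = c  (c fixed separately).
Line : Set
Line = ℕ × ℕ

-- Point (A , a) lies on line B x - b y = c  iff  A B - a b = c,
-- written over ℕ as  A * B ≡ a * b + c.
LiesOn : ℕ → Point → Line → Set
LiesOn c (A , a) (B , b) = A * B ≡ a * b + c

PrimePoint : ℕ → Point → Set
PrimePoint c (A , a) = (gcd A c ≡ 1) × (gcd a c ≡ 1)

PrimeLine : ℕ → Line → Set
PrimeLine c (B , b) = (gcd B c ≡ 1) × (gcd b c ≡ 1)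

-- A cycle in the bipartite incidence graph (parts P and L):
--   pt 0 — ln 0 — pt 1 — ln 1 — … — pt n — ln n — pt 0,
-- with k = n+1 ≥ 2 distinct points and k distinct lines.
-- (A cycle in a simple bipartite graph has length 2k with k ≥ 2.)
record Cycle (c : ℕ) (P : List Point) (L : List Line) : Set where
  field
    n      : ℕ
    n≥1    : 1 ≤ n
    pt     : Fin (suc n) → Point
    ln     : Fin (suc n) → Line
    pt-inj : Injective _≡_ _≡_ pt
    ln-inj : Injective _≡_ _≡_ ln
    pt∈P   : ∀ i → pt i ∈ P
    ln∈L   : ∀ i → ln i ∈ L
    inc    : ∀ i → LiesOn c (pt i) (ln i)
    inc′   : ∀ (i : Fin n) → LiesOn c (pt (suc i)) (ln (inject₁ i))
    close  : LiesOn c (pt zero) (ln (fromℕ n))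

{-# OPTIONS --safe #-}
-- Each vertex of the incidence graph has two distinct neighbours in a cycle, so a contradiction
-- follows from the vertex of largest coordinate sum once we know that a point (A , a) with
-- gcd(A , c) = 1 lies on at most one line (B , b) with B + b ≤ A + a (and dually for lines).
-- For two such lines with b′ ≤ b we get A (B − B′) = a (b − b′); any common divisor of A and a
-- divides c, so A ∣ b − b′. If b ≠ b′ this forces b − b′ ≥ A and B − B′ ≥ a, pushing B + b
-- beyond A + a.
module Submission where

open import Defs
open import Data.Nat using (ℕ; zero; suc; _+_; _*_; _≤_; s≤s; NonZero; ≢-nonZero⁻¹; >-nonZero⁻¹)
open import Data.Nat.Properties
open import Data.Nat.Divisibility using (_∣_; ∣1⇒≡1; ∣m+n∣m⇒∣n; ∣-trans; m∣m*n; ∣⇒≤)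
open import Data.Nat.GCD using (gcd; gcd-greatest; gcd-identityʳ)
open import Data.Nat.Coprimality using (Coprime; coprime-divisor)
open import Data.List using (List; allFin)
open import Data.List.Membership.Propositional using (_∈_)
open import Data.List.Membership.Propositional.Properties using (∈-allFin)
open import Data.List.Relation.Unary.All as All using ()
open import Data.List.Extrema.Nat using (argmax; f[xs]≤f[argmax])
open import Data.Product using (_×_; _,_; proj₁; ∃-syntax)
open import Data.Sum using (inj₁; inj₂)
open import Data.Fin using (Fin; zero; suc; inject₁; fromℕ)
open import Data.Fin.Properties as Fin using (≤̄⇒inject₁<)
open import Data.Fin.Relation.Unary.Top using (view; ‵fromℕ; ‵inject₁)
open import Data.Empty using (⊥; ⊥-elim)
open import Function using (_∘_; case_of_)
open import Relation.Nullary using (¬_)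
open import Relation.Binary.PropositionalEquality
open import Algebra.Properties.CommutativeSemigroup +-commutativeSemigroup using (interchange; xy∙z≈xz∙y)

size : ℕ × ℕ → ℕ
size (u , v) = u + v

LiesOn-sym : ∀ {c} p l → LiesOn c p l → LiesOn c l p
LiesOn-sym {c} (A , a) (B , b) on = trans (*-comm B A) (trans on (cong (_+ c) (*-comm a b)))

LiesOn⇒NonZero : ∀ {c} .{{_ : NonZero c}} A a l → LiesOn c (A , a) l → NonZero A
LiesOn⇒NonZero {c} zero a (B , b) on = ⊥-elim (≢-nonZero⁻¹ c (m+n≡0⇒n≡0 (a * b) (sym on)))
LiesOn⇒NonZero (suc _) _ _ _ = _

LiesOn⇒Coprime : ∀ {c} A a l → gcd A c ≡ 1 → LiesOn c (A , a) l → Coprime A a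
LiesOn⇒Coprime {c} A a (B , b) gcd≡1 on {d} (d∣A , d∣a) =
  ∣1⇒≡1 (subst (d ∣_) gcd≡1 (gcd-greatest d∣A d∣c))
  where
  d∣c : d ∣ c
  d∣c = ∣m+n∣m⇒∣n (subst (d ∣_) on (∣-trans d∣A (m∣m*n B))) (∣-trans d∣a (m∣m*n b))

LiesOn-difference : ∀ {c} A a B b D d →
  LiesOn c (A , a) (B + D , b + d) → LiesOn c (A , a) (B , b) → A * D ≡ a * d
LiesOn-difference {c} A a B b D d on on′ = +-cancelˡ-≡ (A * B) _ _ (begin
  A * B + A * D      ≡⟨ *-distribˡ-+ A B D ⟨
  A * (B + D)        ≡⟨ on ⟩
  a * (b + d) + c    ≡⟨ cong (_+ c) (*-distribˡ-+ a b d) ⟩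
  a * b + a * d + c  ≡⟨ xy∙z≈xz∙y (a * b) (a * d) c ⟩
  a * b + c + a * d  ≡⟨ cong (_+ a * d) on′ ⟨
  A * B + a * d      ∎)
  where open ≡-Reasoning

increment-vanishes : ∀ {c} .{{_ : NonZero c}} A a B b D d → gcd A c ≡ 1 →
  LiesOn c (A , a) (B + D , b + d) → LiesOn c (A , a) (B , b) →
  (B + D) + (b + d) ≤ A + a → (B + D , b + d) ≡ (B , b)
increment-vanishes A a B b D zero _ on on′ _ =
  cong₂ _,_ (trans (cong (B +_) D≡0) (+-identityʳ B)) (+-identityʳ b)
  where
  instance _ = LiesOn⇒NonZero A a _ on
  D≡0 : D ≡ 0
  D≡0 = *-cancelˡ-≡ D 0 A
    (trans (LiesOn-difference A a B b D 0 on on′) (trans (*-zeroʳ a) (sym (*-zeroʳ A))))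
increment-vanishes A a B b D d@(suc _) gcd≡1 on on′ bound =
  ⊥-elim (<-irrefl (+-comm a A) (begin-strict
    a + A              <⟨ m<n+m (a + A) (>-nonZero⁻¹ B) ⟩
    B + (a + A)        ≤⟨ +-monoˡ-≤ (a + A) (m≤m+n B b) ⟩
    B + b + (a + A)    ≤⟨ +-monoʳ-≤ (B + b) (+-mono-≤ a≤D A≤d) ⟩
    B + b + (D + d)    ≡⟨ interchange B b D d ⟩
    B + D + (b + d)    ≤⟨ bound ⟩
    A + a              ∎))
  where
  open ≤-Reasoning
  instance
    _ = LiesOn⇒NonZero A a _ on
    _ = LiesOn⇒NonZero B b _ (LiesOn-sym (A , a) (B , b) on′)
  AD≡ad : A * D ≡ a * d
  AD≡ad = LiesOn-difference A a B b D d on on′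
  A≤d : A ≤ d
  A≤d = ∣⇒≤ (coprime-divisor (LiesOn⇒Coprime A a (B + D , b + d) gcd≡1 on)
    (subst (A ∣_) AD≡ad (m∣m*n D)))
  a≤D : a ≤ D
  a≤D = *-cancelˡ-≤ A (subst₂ _≤_ (*-comm a A) (sym AD≡ad) (*-monoʳ-≤ a {A} {d} A≤d))

bounded-incidence-unique-≤ : ∀ {c} .{{_ : NonZero c}} A a B b B′ b′ → gcd A c ≡ 1 →
  LiesOn c (A , a) (B , b) → LiesOn c (A , a) (B′ , b′) →
  B + b ≤ A + a → b′ ≤ b → (B , b) ≡ (B′ , b′)
bounded-incidence-unique-≤ {c} A a B b B′ b′ gcd≡1 on on′ bound b′≤b
  with m≤n⇒∃[o]m+o≡n b′≤b | m≤n⇒∃[o]m+o≡n B′≤B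
  where
  instance _ = LiesOn⇒NonZero A a _ on
  B′≤B : B′ ≤ B
  B′≤B = *-cancelˡ-≤ A (subst₂ _≤_ (sym on′) (sym on) (+-monoˡ-≤ c (*-monoʳ-≤ a b′≤b)))
... | d , refl | D , refl = increment-vanishes A a B′ b′ D d gcd≡1 on on′ bound

bounded-incidence-unique : ∀ {c} .{{_ : NonZero c}} p l l′ → gcd (proj₁ p) c ≡ 1 →
  LiesOn c p l → LiesOn c p l′ → size l ≤ size p → size l′ ≤ size p → l ≡ l′
bounded-incidence-unique (A , a) (B , b) (B′ , b′) gcd≡1 on on′ bound bound′ with ≤-total b′ b
... | inj₁ b′≤b = bounded-incidence-unique-≤ A a B b B′ b′ gcd≡1 on on′ bound b′≤b
... | inj₂ b≤b′ = sym (bounded-incidence-unique-≤ A a B′ b′ B b gcd≡1 on′ on bound′ b≤b′)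

maximiser : ∀ {m} (f : Fin (suc m) → ℕ) → ∃[ i ] (∀ j → f j ≤ f i)
maximiser {m} f =
  argmax f zero (allFin (suc m)) ,
  λ j → All.lookup (f[xs]≤f[argmax] {f = f} zero (allFin (suc m))) (∈-allFin j)

zero≢fromℕ : ∀ {n} → 1 ≤ n → zero ≢ fromℕ n
zero≢fromℕ (s≤s _) ()

inject₁≢suc : ∀ {n} (i : Fin n) → inject₁ i ≢ suc i
inject₁≢suc i = Fin.<⇒≢ (≤̄⇒inject₁< ≤-refl)

module _ {c P L} (C : Cycle c P L) where
  open Cycle C

  another-line : ∀ i → ∃[ j ] j ≢ i × LiesOn c (pt i) (ln j)
  another-line zero = fromℕ n , zero≢fromℕ n≥1 ∘ sym , close
  another-line (suc k) = inject₁ k , inject₁≢suc k , inc′ k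

  another-point : ∀ j → ∃[ i ] i ≢ j × LiesOn c (pt i) (ln j)
  another-point j with view j
  ... | ‵fromℕ = zero , zero≢fromℕ n≥1 , close
  ... | ‵inject₁ k = suc k , inject₁≢suc k ∘ sym , inc′ k

  module _ .{{_ : NonZero c}}
    (hP : ∀ p → p ∈ P → PrimePoint c p) (hL : ∀ l → l ∈ L → PrimeLine c l) where

    no-maximal-point : ∀ i → ¬ (∀ j → size (ln j) ≤ size (pt i))
    no-maximal-point i maximal with another-line i
    ... | j , j≢i , on = j≢i (ln-inj (bounded-incidence-unique (pt i) (ln j) (ln i)
      (proj₁ (hP (pt i) (pt∈P i))) on (inc i) (maximal j) (maximal i)))

    no-maximal-line : ∀ j → ¬ (∀ i → size (pt i) ≤ size (ln j))
    no-maximal-line j maximal with another-point j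
    ... | i , i≢j , on = i≢j (pt-inj (bounded-incidence-unique (ln j) (pt i) (pt j)
      (proj₁ (hL (ln j) (ln∈L j))) (LiesOn-sym (pt i) (ln j) on) (LiesOn-sym (pt j) (ln j) (inc j))
      (maximal i) (maximal j)))

    cycle-absurd : ⊥
    cycle-absurd =
      let i , i-max = maximiser (size ∘ pt)
          j , j-max = maximiser (size ∘ ln)
      in case ≤-total (size (ln j)) (size (pt i)) of λ where
        (inj₁ ln≤pt) → no-maximal-point i (λ j′ → ≤-trans (j-max j′) ln≤pt)
        (inj₂ pt≤ln) → no-maximal-line j (λ i′ → ≤-trans (i-max i′) pt≤ln)

lemma2p2 : (c : ℕ) (P : List Point) (L : List Line) →
    (∀ p → p ∈ P → PrimePoint c p) →
    (∀ l → l ∈ L → PrimeLine c l) →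
    ¬ Cycle c P L
lemma2p2 (suc c) P L hP hL C = cycle-absurd C hP hL
lemma2p2 zero _ _ hP _ C = zero≢fromℕ n≥1 (pt-inj (trans (unit zero) (sym (unit (fromℕ n)))))
  where
  open Cycle C
  -- gcd x 0 = x, so for c = 0 every point of P is (1 , 1).
  unit : ∀ i → pt i ≡ (1 , 1)
  unit i = let gcd≡1 , gcd′≡1 = hP (pt i) (pt∈P i) in
    cong₂ _,_ (trans (sym (gcd-identityʳ _)) gcd≡1) (trans (sym (gcd-identityʳ _)) gcd′≡1)
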